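{- Let $G$ be a 4-connected plane graph such that $G[\mathrm{N}(u)]$ is connected for every vertex $u$ of $G$. Then $G$ has no stable minimal cut, i.e., no minimal cut of $G$ is an independent set.
   Context: A cut of a connected graph $G=(V,E)$ is a set $S\subset V$ with $G-S$ disconnected; it is minimal if $G-T$ is connected for every proper subset $T\subset S$; it is stable if $G[S]$ has no edges. $\mathrm{N}(u)$ is the set of neighbours of $u$. -}

module Defs where

open import Data.Nat using (ℕ; zero; suc; _+_; _*_; _<_)
open import Data.Bool using (Bool; true; false; T)
open import Data.Fin using (Fin) renaming (zero to fzero; suc to fsuc)
open import Data.Fin.Subset using (Subset; _∈_; _⊂_; ∁; ∣_∣)
open import Data.Vec using (tabulate)
open import Data.Product using (Σ; _×_; _,_; ∃)
open import Relation.Nullary using (¬_)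
open import Relation.Binary.PropositionalEquality using (_≡_)

record Graph (n : ℕ) : Set where
  field
    adj    : Fin n → Fin n → Bool
    adj-sym : ∀ u v → adj u v ≡ adj v u
    adj-irr : ∀ u → adj u u ≡ false
open Graph public

module _ {n : ℕ} (G : Graph n) where

  Adj : Fin n → Fin n → Set
  Adj u v = T (adj G u v)

  N : Fin n → Subset n
  N u = tabulate (adj G u)

  data Path (A : Subset n) : Fin n → Fin n → Set where
    here : ∀ {u} → u ∈ A → Path A u u
    step : ∀ {u v w} → u ∈ A → Adj u v → Path A v w → Path A u w

  -- G[A] is connected (empty vertex set counts as connected)
  ConnectedOn : Subset n → Set
  ConnectedOn A = ∀ u v → u ∈ A → v ∈ A → Path A u v

  Cut : Subset n → Set
  Cut S = ¬ ConnectedOn (∁ S)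

  MinimalCut : Subset n → Set
  MinimalCut S = Cut S × (∀ T → T ⊂ S → ConnectedOn (∁ T))

  Stable : Subset n → Set
  Stable S = ∀ u v → u ∈ S → v ∈ S → ¬ Adj u v

  KConnected : ℕ → Set
  KConnected k = (k < n) × (∀ X → ∣ X ∣ < k → ConnectedOn (∁ X))

  LocallyConnected : Set
  LocallyConnected = ∀ u → ConnectedOn (N u)

  -- number of darts (= 2 |E|)
  sumDeg : ℕ
  sumDeg = go n (λ i → i)
    where
    go : (m : ℕ) → (Fin m → Fin n) → ℕ
    go zero    f = 0
    go (suc m) f = ∣ N (f fzero) ∣ + go m (λ i → f (fsuc i))

iter : {A : Set} → (A → A) → ℕ → A → A
iter f zero    x = x
iter f (suc k) x = f (iter f k x)

record RotationSystem {n : ℕ} (G : Graph n) : Set where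
  field
    ρ : Fin n → Fin n → Fin n
    ρ-closed : ∀ u v → v ∈ N G u → ρ u v ∈ N G u
    ρ-inj    : ∀ u v w → v ∈ N G u → w ∈ N G u → ρ u v ≡ ρ u w → v ≡ w
    ρ-cyclic : ∀ u v w → v ∈ N G u → w ∈ N G u → ∃ λ k → iter (ρ u) k v ≡ w

  Dart : Fin n × Fin n → Set
  Dart (u , v) = Adj G u v

  φ : Fin n × Fin n → Fin n × Fin n
  φ (u , v) = (v , ρ v u)

  SameFace : Fin n × Fin n → Fin n × Fin n → Set
  SameFace d e = ∃ λ k → iter φ k d ≡ e

  HasFaces : ℕ → Set
  HasFaces F = Σ (Fin n × Fin n → Fin F) λ face →
      (∀ f → Σ (Fin n × Fin n) λ d → Dart d × face d ≡ f)
    × (∀ d e → Dart d → Dart e → (face d ≡ face e → SameFace d e) × (SameFace d e → face d ≡ face e))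

-- A connected graph is planar (admits a plane embedding) iff it has a rotation
-- system of genus 0, i.e. with F faces satisfying Euler's formula n - |E| + F = 2,
-- written here as 2n + 2F = 2|E| + 4.
Planar : {n : ℕ} → Graph n → Set
Planar {n} G = Σ (RotationSystem G) λ R → Σ ℕ λ F →
  RotationSystem.HasFaces R F × (2 * n + 2 * F ≡ sumDeg G + 4)

-- Take a vertex u of the stable minimal cut S.  By minimality G - (S - u) is
-- connected, and by stability N(u) lies in G - S.  A walk of G - (S - u) between
-- vertices of G - S enters u from some x ∈ N(u) and finally leaves it towards
-- some y ∈ N(u); replacing the detour x … y by a walk in the connected graph
-- G[N(u)] gives a walk in G - S, so S is not a cut after all.
module Submission where

open import Defs
open import Data.Nat using (ℕ; suc; _<_; z≤n; s≤s)
open import Data.Bool using (T)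
open import Data.Bool.Properties using (T-≡)
open import Data.Fin using (Fin; _≟_)
open import Data.Fin.Subset using (Subset; _∈_; _∉_; _⊆_; ∁; _-_; ⊥; Nonempty)
open import Data.Fin.Subset.Properties
  using (_∈?_; nonempty?; Empty-unique; ∣⊥∣≡0; x∈p⇒p-x⊂p; x∈p∧x≢y⇒x∈p-y;
         p─q⊆p; p⊆q⇒∁p⊇∁q; x∈∁p⇒x∉p; x∉p⇒x∈∁p; x∉∁p⇒x∈p)
open import Data.Vec.Properties using (lookup∘tabulate; []=⇒lookup; lookup⇒[]=)
open import Data.Product using (Σ-syntax; _×_; _,_)
open import Data.Sum using (_⊎_; inj₁; inj₂)
open import Function.Bundles using (Equivalence)
open import Relation.Nullary using (¬_; yes; no; contradiction)
open import Relation.Binary.PropositionalEquality using (_≡_; sym; trans; subst)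

module _ {n : ℕ} (G : Graph n) where

  Adj-sym : ∀ {u v} → Adj G u v → Adj G v u
  Adj-sym {u} {v} = subst T (adj-sym G u v)

  ∈N⇒Adj : ∀ {u v} → v ∈ N G u → Adj G u v
  ∈N⇒Adj {u} {v} v∈Nu =
    Equivalence.from T-≡ (trans (sym (lookup∘tabulate (adj G u) v)) ([]=⇒lookup v∈Nu))

  Adj⇒∈N : ∀ {u v} → Adj G u v → v ∈ N G u
  Adj⇒∈N {u} {v} uv =
    lookup⇒[]= v (N G u) (trans (lookup∘tabulate (adj G u) v) (Equivalence.to T-≡ uv))

  Path-head : ∀ {A x y} → Path G A x y → x ∈ A
  Path-head (here x∈A)     = x∈A
  Path-head (step x∈A _ _) = x∈A

  Path-++ : ∀ {A x y z} → Path G A x y → Path G A y z → Path G A x z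
  Path-++ (here _)       q = q
  Path-++ (step x∈A e p) q = step x∈A e (Path-++ p q)

  Path-reverse : ∀ {A x y} → Path G A x y → Path G A y x
  Path-reverse (here x∈A)     = here x∈A
  Path-reverse (step x∈A e p) = Path-++ (Path-reverse p) (step (Path-head p) (Adj-sym e) (here x∈A))

  Path-mono : ∀ {A B x y} → A ⊆ B → Path G A x y → Path G B x y
  Path-mono A⊆B (here x∈A)     = here (A⊆B x∈A)
  Path-mono A⊆B (step x∈A e p) = step (A⊆B x∈A) e (Path-mono A⊆B p)

  -- Throughout, A plays the role of B ∪ {u}.
  module _ {A B : Subset n} {u : Fin n} (∈A∖B⇒≡u : ∀ {x} → x ∈ A → x ∉ B → x ≡ u) where

    Path-avoids-or-reaches-N : ∀ {v w} → v ∈ B → Path G A v w →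
      Path G B v w ⊎ (Σ[ x ∈ Fin n ] x ∈ N G u × Path G B v x)
    Path-avoids-or-reaches-N v∈B (here _) = inj₁ (here v∈B)
    Path-avoids-or-reaches-N {v} v∈B (step {v = w} _ vw p) with w ∈? B
    ... | no w∉B =
      inj₂ (v , Adj⇒∈N (Adj-sym (subst (Adj G v) (∈A∖B⇒≡u (Path-head p) w∉B) vw)) , here v∈B)
    ... | yes w∈B with Path-avoids-or-reaches-N w∈B p
    ...   | inj₁ q           = inj₁ (step v∈B vw q)
    ...   | inj₂ (x , x∈N , q) = inj₂ (x , x∈N , step v∈B vw q)

    ConnectedOn-remove-vertex : B ⊆ A → N G u ⊆ B → ConnectedOn G (N G u) →
      ConnectedOn G A → ConnectedOn G B
    ConnectedOn-remove-vertex B⊆A N⊆B N-conn A-conn a b a∈B b∈B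
      with p ← A-conn a b (B⊆A a∈B) (B⊆A b∈B)
      with Path-avoids-or-reaches-N a∈B p | Path-avoids-or-reaches-N b∈B (Path-reverse p)
    ... | inj₁ q             | _                  = q
    ... | inj₂ _             | inj₁ q             = Path-reverse q
    ... | inj₂ (x , x∈N , q) | inj₂ (y , y∈N , r) =
      Path-++ q (Path-++ (Path-mono N⊆B (N-conn x y x∈N y∈N)) (Path-reverse r))

  Cut-nonempty : ∀ {k S} → KConnected G (suc k) → Cut G S → Nonempty S
  Cut-nonempty {k} {S} (_ , connected) cut with nonempty? S
  ... | yes S≢∅ = S≢∅
  ... | no S≡∅ = contradiction (subst (λ X → ConnectedOn G (∁ X)) (sym (Empty-unique S≡∅)) G-conn) cut
    where
    G-conn : ConnectedOn G (∁ ⊥)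
    G-conn = connected ⊥ (subst (_< suc k) (sym (∣⊥∣≡0 n)) (s≤s z≤n))

  ∈∁[S-u]∧∉∁S⇒≡u : ∀ {S : Subset n} {u x} → x ∈ ∁ (S - u) → x ∉ ∁ S → x ≡ u
  ∈∁[S-u]∧∉∁S⇒≡u {u = u} {x} x∈∁[S-u] x∉∁S with x ≟ u
  ... | yes x≡u = x≡u
  ... | no x≢u  = contradiction (x∈p∧x≢y⇒x∈p-y (x∉∁p⇒x∈p x∉∁S) x≢u) (x∈∁p⇒x∉p x∈∁[S-u])

  Stable⇒N⊆∁ : ∀ {S : Subset n} {u} → Stable G S → u ∈ S → N G u ⊆ ∁ S
  Stable⇒N⊆∁ stable u∈S v∈Nu = x∉p⇒x∈∁p (λ v∈S → stable _ _ u∈S v∈S (∈N⇒Adj v∈Nu))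

corollary23 : (n : ℕ) (G : Graph n) → KConnected G 4 → Planar G → LocallyConnected G →
    (S : Subset n) → ¬ (MinimalCut G S × Stable G S)
corollary23 n G κ _ locally-connected S ((cut , minimal) , stable)
  with u , u∈S ← Cut-nonempty G κ cut =
  cut (ConnectedOn-remove-vertex G (∈∁[S-u]∧∉∁S⇒≡u G)
        (p⊆q⇒∁p⊇∁q (p─q⊆p S _))
        (Stable⇒N⊆∁ G stable u∈S)
        (locally-connected u)
        (minimal (S - u) (x∈p⇒p-x⊂p u∈S)))
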